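{- Backward proof-search in $\mathsf{G}(\mathbf{KT_n^+})$ always terminates: there is no infinite sequence of T-sequents $S_0,S_1,S_2,\dots$ such that for every $k$, $S_{k+1}$ is a premise of some rule instance of $\mathsf{G}(\mathbf{KT_n^+})$ whose conclusion is $S_k$.
   Context: Formulas of $\mathcal{L}^1$ over a finite agent set and countable $\mathsf{Prop}$: $A::=p\mid\bot\mid A\wedge A\mid A\vee A\mid A\rightarrow A\mid\neg A\mid\Box_i A$. Outmost-boxed formula: $\Box_jB$; $\Box_i\Gamma=\{\Box_iA:A\in\Gamma\}$. A T-sequent $\Sigma|\Gamma\Rightarrow\Delta$ consists of finite multisets $\Sigma,\Gamma,\Delta$ with $\Sigma$ consisting of outmost-boxed formulas. $\mathsf{G}(\mathbf{KT_n^+})$: initial T-sequents $\Sigma|\Gamma,p\Rightarrow p,\Delta$ and $\Sigma|\bot,\Gamma\Rightarrow\Delta$; logical rules (with $\Sigma$ unchanged): $(R\wedge)$ $\Sigma|\Gamma\Rightarrow\Delta,A_1$ and $\Sigma|\Gamma\Rightarrow\Delta,A_2$ / $\Sigma|\Gamma\Rightarrow\Delta,A_1\wedge A_2$; $(L\wedge)$ $\Sigma|A_1,A_2,\Gamma\Rightarrow\Delta$ / $\Sigma|A_1\wedge A_2,\Gamma\Rightarrow\Delta$; $(R\vee)$ $\Sigma|\Gamma\Rightarrow\Delta,A_1,A_2$ / $\Sigma|\Gamma\Rightarrow\Delta,A_1\vee A_2$; $(L\vee)$ $\Sigma|A_1,\Gamma\Rightarrow\Delta$ and $\Sigma|A_2,\Gamma\Rightarrow\Delta$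 / $\Sigma|A_1\vee A_2,\Gamma\Rightarrow\Delta$; $(R\rightarrow)$ $\Sigma|A_1,\Gamma\Rightarrow\Delta,A_2$ / $\Sigma|\Gamma\Rightarrow\Delta,A_1\rightarrow A_2$; $(L\rightarrow)$ $\Sigma|\Gamma\Rightarrow\Delta,A_1$ and $\Sigma|A_2,\Gamma\Rightarrow\Delta$ / $\Sigma|A_1\rightarrow A_2,\Gamma\Rightarrow\Delta$; $(R\neg)$ $\Sigma|A,\Gamma\Rightarrow\Delta$ / $\Sigma|\Gamma\Rightarrow\Delta,\neg A$; $(L\neg)$ $\Sigma|\Gamma\Rightarrow\Delta,A$ / $\Sigma|\neg A,\Gamma\Rightarrow\Delta$. Modal rules: $(\Box^+_{Kn})$: from $\emptyset|\Gamma\Rightarrow A$ infer $\Sigma,\Box_i\Gamma|\Pi\Rightarrow\Box_iA,\Omega$, where $\Sigma$ contains only formulas $\Box_jB$ with $j\neq i$, $\Pi$ only propositional variables and $\bot$, $\Omega$ only propositional variables, $\bot$, or outmost-boxed formulas; $(\Box^+_{Tn})$: from $\Box_iA,\Sigma|\Gamma,A\Rightarrow\Delta$ infer $\Sigma|\Gamma,\Box_iA\Rightarrow\Delta$. -}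

module Defs where

open import Data.Nat using (ℕ; suc)
open import Data.Fin using (Fin)
open import Data.List using (List; []; _∷_; _++_; map)
open import Data.List.Relation.Unary.All using (All)
open import Data.List.Relation.Binary.Permutation.Propositional using (_↭_)
open import Data.Product using (Σ; _×_; _,_; proj₁; proj₂; ∃)
open import Relation.Binary.PropositionalEquality using (_≢_)

module _ (n : ℕ) where

  Agent : Set
  Agent = Fin n

  data Fm : Set where
    var  : ℕ → Fm
    ⊥'   : Fm
    _∧'_ : Fm → Fm → Fm
    _∨'_ : Fm → Fm → Fm
    _⇒'_ : Fm → Fm → Fm
    ¬'_  : Fm → Fm
    □    : Agent → Fm → Fm

  data Boxed : Fm → Set where
    boxed : ∀ j B → Boxed (□ j B)

  data BoxedOther (i : Agent) : Fm → Set where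
    boxedOther : ∀ j B → j ≢ i → BoxedOther i (□ j B)

  data AtomOrBot : Fm → Set where
    atom : ∀ p → AtomOrBot (var p)
    bot  : AtomOrBot ⊥'

  data AtomBotOrBoxed : Fm → Set where
    atom  : ∀ p → AtomBotOrBoxed (var p)
    bot   : AtomBotOrBoxed ⊥'
    boxed : ∀ j B → AtomBotOrBoxed (□ j B)

  -- Raw sequent Σ | Γ ⇒ Δ, multisets represented by lists (compared up to permutation).
  record Seq : Set where
    constructor _∣_⇒_
    field
      Σs : List Fm
      Γs : List Fm
      Δs : List Fm
  open Seq public

  TSeq : Set
  TSeq = Σ Seq (λ s → All Boxed (Σs s))

  _≈ₛ_ : Seq → Seq → Set
  s ≈ₛ t = (Σs s ↭ Σs t) × (Γs s ↭ Γs t) × (Δs s ↭ Δs t)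

  -- Premise P C : P is a premise of a rule instance of G(KTn+) with conclusion C.
  -- Initial sequents have no premises, hence no constructors.
  data Premise : Seq → Seq → Set where
    R∧₁ : ∀ {S Γ Δ A₁ A₂} → Premise (S ∣ Γ ⇒ (A₁ ∷ Δ)) (S ∣ Γ ⇒ ((A₁ ∧' A₂) ∷ Δ))
    R∧₂ : ∀ {S Γ Δ A₁ A₂} → Premise (S ∣ Γ ⇒ (A₂ ∷ Δ)) (S ∣ Γ ⇒ ((A₁ ∧' A₂) ∷ Δ))
    L∧  : ∀ {S Γ Δ A₁ A₂} → Premise (S ∣ (A₁ ∷ A₂ ∷ Γ) ⇒ Δ) (S ∣ ((A₁ ∧' A₂) ∷ Γ) ⇒ Δ)
    R∨  : ∀ {S Γ Δ A₁ A₂} → Premise (S ∣ Γ ⇒ (A₁ ∷ A₂ ∷ Δ)) (S ∣ Γ ⇒ ((A₁ ∨' A₂) ∷ Δ))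
    L∨₁ : ∀ {S Γ Δ A₁ A₂} → Premise (S ∣ (A₁ ∷ Γ) ⇒ Δ) (S ∣ ((A₁ ∨' A₂) ∷ Γ) ⇒ Δ)
    L∨₂ : ∀ {S Γ Δ A₁ A₂} → Premise (S ∣ (A₂ ∷ Γ) ⇒ Δ) (S ∣ ((A₁ ∨' A₂) ∷ Γ) ⇒ Δ)
    R⇒  : ∀ {S Γ Δ A₁ A₂} → Premise (S ∣ (A₁ ∷ Γ) ⇒ (A₂ ∷ Δ)) (S ∣ Γ ⇒ ((A₁ ⇒' A₂) ∷ Δ))
    L⇒₁ : ∀ {S Γ Δ A₁ A₂} → Premise (S ∣ Γ ⇒ (A₁ ∷ Δ)) (S ∣ ((A₁ ⇒' A₂) ∷ Γ) ⇒ Δ)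
    L⇒₂ : ∀ {S Γ Δ A₁ A₂} → Premise (S ∣ (A₂ ∷ Γ) ⇒ Δ) (S ∣ ((A₁ ⇒' A₂) ∷ Γ) ⇒ Δ)
    R¬  : ∀ {S Γ Δ A} → Premise (S ∣ (A ∷ Γ) ⇒ Δ) (S ∣ Γ ⇒ ((¬' A) ∷ Δ))
    L¬  : ∀ {S Γ Δ A} → Premise (S ∣ Γ ⇒ (A ∷ Δ)) (S ∣ ((¬' A) ∷ Γ) ⇒ Δ)
    □Kn : ∀ {S Γ Π Ω A i} → All (BoxedOther i) S → All AtomOrBot Π → All AtomBotOrBoxed Ω →
          Premise ([] ∣ Γ ⇒ (A ∷ [])) ((S ++ map (□ i) Γ) ∣ Π ⇒ (□ i A ∷ Ω))
    □Tn : ∀ {S Γ Δ A i} →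
          Premise ((□ i A ∷ S) ∣ (A ∷ Γ) ⇒ Δ) (S ∣ (□ i A ∷ Γ) ⇒ Δ)

  Step : TSeq → TSeq → Set
  Step S S' = ∃ λ C → ∃ λ P → Premise P C × (proj₁ S ≈ₛ C) × (proj₁ S' ≈ₛ P)

-- Measure a sequent by the lexicographic pair (d , w), where d bounds the modal
-- depth of all its formulas and w is the total size of Γ and Δ.  Every logical
-- rule and (□Tn) keep d and lower w — the formula □ᵢA that (□Tn) copies into Σ
-- is not counted by w — while the premise of (□Kn) consists of bodies of boxes of
-- the conclusion and so lowers d.  The lexicographic order on ℕ × ℕ is
-- well-founded, so no infinite chain of backward steps exists.
module Submission where

open import Defs
open import Data.Nat using (ℕ; suc; _+_; _⊔_; _≤_; _<_; z≤n; s≤s)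
open import Data.Nat.Induction using (<-wellFounded)
open import Data.Nat.ListAction using (sum)
open import Data.Nat.ListAction.Properties using (sum-++; sum-↭)
open import Data.Nat.Properties
  using (≤-reflexive; ≤-trans; n<1+n; ≤-pred; <⇒≤; +-comm; +-assoc; +-identityʳ; +-monoʳ-≤; +-monoˡ-<;
         m⊔n≤o⇒m≤o; m⊔n≤o⇒n≤o; +-commutativeSemigroup; module ≤-Reasoning)
open import Data.List using (List; []; _∷_; [_]; _++_; map)
open import Data.List.Properties using (map-++)
open import Data.List.Extrema.Nat using (max; xs≤max)
open import Data.List.Relation.Unary.All as All using (All; []; _∷_)
open import Data.List.Relation.Unary.All.Properties using (++⁻; ++⁻ʳ; map⁻)
open import Data.List.Relation.Binary.Permutation.Propositional using (↭-sym)
open import Data.List.Relation.Binary.Permutation.Propositional.Properties using (All-resp-↭; map⁺)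
open import Data.Product using (Σ; ∃; _×_; _,_; proj₁)
open import Data.Product.Relation.Binary.Lex.Strict using (×-Lex; ×-wellFounded)
open import Data.Sum using (inj₁; inj₂)
open import Function using (_∘_)
open import Induction.WellFounded using (WellFounded; Acc; acc)
open import Level using (Level)
open import Relation.Binary using (Rel)
open import Relation.Nullary using (¬_)
open import Relation.Binary.PropositionalEquality using (_≡_; refl; sym; trans; cong; cong₂; subst₂)
open import Algebra.Properties.CommutativeSemigroup +-commutativeSemigroup using (interchange; x∙yz≈y∙xz)

module _ {a b ℓ r s : Level} {A : Set a} {B : Set b} {_<_ : Rel B ℓ} {R : Rel A r}
         (Ranked : B → A → Set s)
         (descend : ∀ {β x y} → Ranked β x → R x y → ∃ λ β′ → β′ < β × Ranked β′ y)
         where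

  wellFounded⇒no-ranked-chain : WellFounded _<_ → ∀ {β} (f : ℕ → A) →
                                Ranked β (f 0) → ¬ (∀ k → R (f k) (f (suc k)))
  wellFounded⇒no-ranked-chain wf {β} = go (wf β)
    where
    go : ∀ {β} → Acc _<_ β → (f : ℕ → A) → Ranked β (f 0) → ¬ (∀ k → R (f k) (f (suc k)))
    go (acc rs) f ranked chain with descend ranked (chain 0)
    ... | _ , β′<β , ranked′ = go (rs β′<β) (f ∘ suc) ranked′ (chain ∘ suc)

_<ₗₑₓ_ : Rel (ℕ × ℕ) _
_<ₗₑₓ_ = ×-Lex _≡_ _<_ _<_

-- The bounds sizes (As ++ Bs) < size F of the rules, where sizes [ A ] reduces to size A + 0.
m+0<1+m+n : ∀ m n → m + 0 < suc (m + n)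
m+0<1+m+n m n = s≤s (+-monoʳ-≤ m z≤n)

n+0<1+m+n : ∀ m n → n + 0 < suc (m + n)
n+0<1+m+n m n = s≤s (≤-trans (+-monoʳ-≤ n z≤n) (≤-reflexive (+-comm n m)))

m+[n+0]<1+m+n : ∀ m n → m + (n + 0) < suc (m + n)
m+[n+0]<1+m+n m n = s≤s (+-monoʳ-≤ m (≤-reflexive (+-identityʳ n)))

m+0<1+m : ∀ m → m + 0 < suc m
m+0<1+m m = s≤s (≤-reflexive (+-identityʳ m))

module _ {n : ℕ} where

  depth : Fm n → ℕ
  depth (var _)  = 0
  depth ⊥'       = 0
  depth (A ∧' B) = depth A ⊔ depth B
  depth (A ∨' B) = depth A ⊔ depth B
  depth (A ⇒' B) = depth A ⊔ depth B
  depth (¬' A)   = depth A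
  depth (□ _ A)  = suc (depth A)

  size : Fm n → ℕ
  size (var _)  = 1
  size ⊥'       = 1
  size (A ∧' B) = suc (size A + size B)
  size (A ∨' B) = suc (size A + size B)
  size (A ⇒' B) = suc (size A + size B)
  size (¬' A)   = suc (size A)
  size (□ _ A)  = suc (size A)

  sizes : List (Fm n) → ℕ
  sizes = sum ∘ map size

  sizes-++ : ∀ xs ys → sizes (xs ++ ys) ≡ sizes xs + sizes ys
  sizes-++ xs ys = trans (cong sum (map-++ size xs ys)) (sum-++ (map size xs) (map size ys))

  weight : Seq n → ℕ
  weight s = sizes (Γs s) + sizes (Δs s)

  weight-resp-≈ₛ : ∀ {s t} → _≈ₛ_ n s t → weight s ≡ weight t
  weight-resp-≈ₛ (_ , Γ↭ , Δ↭) = cong₂ _+_ (sum-↭ (map⁺ size Γ↭)) (sum-↭ (map⁺ size Δ↭))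

  module _ {Σ Σ′ Γ Δ : List (Fm n)} (As Bs : List (Fm n)) {F : Fm n} where
    open ≤-Reasoning

    weight-replace-antecedent : sizes (As ++ Bs) < size F →
                                weight (Σ′ ∣ (As ++ Γ) ⇒ (Bs ++ Δ)) < weight (Σ ∣ (F ∷ Γ) ⇒ Δ)
    weight-replace-antecedent parts<F = begin-strict
      sizes (As ++ Γ) + sizes (Bs ++ Δ)           ≡⟨ cong₂ _+_ (sizes-++ As Γ) (sizes-++ Bs Δ) ⟩
      (sizes As + sizes Γ) + (sizes Bs + sizes Δ) ≡⟨ interchange (sizes As) (sizes Γ) (sizes Bs) (sizes Δ) ⟩
      (sizes As + sizes Bs) + (sizes Γ + sizes Δ) ≡⟨ cong (_+ (sizes Γ + sizes Δ)) (sym (sizes-++ As Bs)) ⟩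
      sizes (As ++ Bs) + (sizes Γ + sizes Δ)      <⟨ +-monoˡ-< (sizes Γ + sizes Δ) parts<F ⟩
      size F + (sizes Γ + sizes Δ)                ≡⟨ sym (+-assoc (size F) (sizes Γ) (sizes Δ)) ⟩
      size F + sizes Γ + sizes Δ                  ∎

    weight-replace-succedent : sizes (As ++ Bs) < size F →
                               weight (Σ′ ∣ (As ++ Γ) ⇒ (Bs ++ Δ)) < weight (Σ ∣ Γ ⇒ (F ∷ Δ))
    weight-replace-succedent parts<F = begin-strict
      weight (Σ′ ∣ (As ++ Γ) ⇒ (Bs ++ Δ)) <⟨ weight-replace-antecedent parts<F ⟩
      size F + sizes Γ + sizes Δ          ≡⟨ +-assoc (size F) (sizes Γ) (sizes Δ) ⟩
      size F + (sizes Γ + sizes Δ)        ≡⟨ x∙yz≈y∙xz (size F) (sizes Γ) (sizes Δ) ⟩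
      sizes Γ + (size F + sizes Δ)        ∎

  Bounded : ℕ → List (Fm n) → Set
  Bounded d = All (λ A → depth A ≤ d)

  DepthBounded : ℕ → Seq n → Set
  DepthBounded d s = Bounded d (Σs s) × Bounded d (Γs s) × Bounded d (Δs s)

  DepthBounded-resp-≈ₛ : ∀ {d s t} → _≈ₛ_ n s t → DepthBounded d s → DepthBounded d t
  DepthBounded-resp-≈ₛ (Σ↭ , Γ↭ , Δ↭) (bΣ , bΓ , bΔ) = All-resp-↭ Σ↭ bΣ , All-resp-↭ Γ↭ bΓ , All-resp-↭ Δ↭ bΔ

  maxDepth : List (Fm n) → ℕ
  maxDepth xs = max 0 (map depth xs)

  Bounded-maxDepth : ∀ xs → Bounded (maxDepth xs) xs
  Bounded-maxDepth xs = map⁻ (xs≤max 0 (map depth xs))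

  DepthBounded-maxDepth : ∀ s → DepthBounded (maxDepth (Σs s ++ Γs s ++ Δs s)) s
  DepthBounded-maxDepth (Σ ∣ Γ ⇒ Δ) =
    let bΣ , bΓΔ = ++⁻ Σ (Bounded-maxDepth (Σ ++ Γ ++ Δ))
        bΓ , bΔ  = ++⁻ Γ bΓΔ
    in  bΣ , bΓ , bΔ

  data Descends : ℕ → Seq n → Seq n → Set where
    lighter   : ∀ {d P C} → DepthBounded d P → weight P < weight C → Descends d P C
    shallower : ∀ {d P C} → DepthBounded d P → Descends (suc d) P C

  module _ {d : ℕ} {Σ Σ′ Γ Δ : List (Fm n)} (As Bs : List (Fm n)) {F : Fm n} where

    replace-antecedent : DepthBounded d (Σ′ ∣ (As ++ Γ) ⇒ (Bs ++ Δ)) → sizes (As ++ Bs) < size F →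
                         Descends d (Σ′ ∣ (As ++ Γ) ⇒ (Bs ++ Δ)) (Σ ∣ (F ∷ Γ) ⇒ Δ)
    replace-antecedent bP parts<F = lighter bP (weight-replace-antecedent {Σ} {Σ′} {Γ} {Δ} As Bs parts<F)

    replace-succedent : DepthBounded d (Σ′ ∣ (As ++ Γ) ⇒ (Bs ++ Δ)) → sizes (As ++ Bs) < size F →
                        Descends d (Σ′ ∣ (As ++ Γ) ⇒ (Bs ++ Δ)) (Σ ∣ Γ ⇒ (F ∷ Δ))
    replace-succedent bP parts<F = lighter bP (weight-replace-succedent {Σ} {Σ′} {Γ} {Δ} As Bs parts<F)

  descends⇒<ₗₑₓ : ∀ {d P C} → Descends d P C →
                  ∃ λ d′ → (d′ , weight P) <ₗₑₓ (d , weight C) × DepthBounded d′ P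
  descends⇒<ₗₑₓ (lighter bP P<C) = _ , inj₂ (refl , P<C) , bP
  descends⇒<ₗₑₓ (shallower bP)   = _ , inj₁ (n<1+n _) , bP

  premise-descends : ∀ {d P C} → Premise n P C → DepthBounded d C → Descends d P C
  premise-descends (R∧₁ {A₁ = A} {B}) (bΣ , bΓ , b ∷ bΔ) =
    replace-succedent [] [ A ] (bΣ , bΓ , m⊔n≤o⇒m≤o _ _ b ∷ bΔ) (m+0<1+m+n (size A) (size B))
  premise-descends (R∧₂ {A₁ = A} {B}) (bΣ , bΓ , b ∷ bΔ) =
    replace-succedent [] [ B ] (bΣ , bΓ , m⊔n≤o⇒n≤o _ _ b ∷ bΔ) (n+0<1+m+n (size A) (size B))
  premise-descends (L∧ {A₁ = A} {B}) (bΣ , b ∷ bΓ , bΔ) =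
    replace-antecedent (A ∷ B ∷ []) [] (bΣ , m⊔n≤o⇒m≤o _ _ b ∷ m⊔n≤o⇒n≤o _ _ b ∷ bΓ , bΔ)
      (m+[n+0]<1+m+n (size A) (size B))
  premise-descends (R∨ {A₁ = A} {B}) (bΣ , bΓ , b ∷ bΔ) =
    replace-succedent [] (A ∷ B ∷ []) (bΣ , bΓ , m⊔n≤o⇒m≤o _ _ b ∷ m⊔n≤o⇒n≤o _ _ b ∷ bΔ)
      (m+[n+0]<1+m+n (size A) (size B))
  premise-descends (L∨₁ {A₁ = A} {B}) (bΣ , b ∷ bΓ , bΔ) =
    replace-antecedent [ A ] [] (bΣ , m⊔n≤o⇒m≤o _ _ b ∷ bΓ , bΔ) (m+0<1+m+n (size A) (size B))
  premise-descends (L∨₂ {A₁ = A} {B}) (bΣ , b ∷ bΓ , bΔ) =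
    replace-antecedent [ B ] [] (bΣ , m⊔n≤o⇒n≤o _ _ b ∷ bΓ , bΔ) (n+0<1+m+n (size A) (size B))
  premise-descends (R⇒ {A₁ = A} {B}) (bΣ , bΓ , b ∷ bΔ) =
    replace-succedent [ A ] [ B ] (bΣ , m⊔n≤o⇒m≤o _ _ b ∷ bΓ , m⊔n≤o⇒n≤o _ _ b ∷ bΔ)
      (m+[n+0]<1+m+n (size A) (size B))
  premise-descends (L⇒₁ {A₁ = A} {B}) (bΣ , b ∷ bΓ , bΔ) =
    replace-antecedent [] [ A ] (bΣ , bΓ , m⊔n≤o⇒m≤o _ _ b ∷ bΔ) (m+0<1+m+n (size A) (size B))
  premise-descends (L⇒₂ {A₁ = A} {B}) (bΣ , b ∷ bΓ , bΔ) =
    replace-antecedent [ B ] [] (bΣ , m⊔n≤o⇒n≤o _ _ b ∷ bΓ , bΔ) (n+0<1+m+n (size A) (size B))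
  premise-descends (R¬ {A = A}) (bΣ , bΓ , b ∷ bΔ) =
    replace-succedent [ A ] [] (bΣ , b ∷ bΓ , bΔ) (m+0<1+m (size A))
  premise-descends (L¬ {A = A}) (bΣ , b ∷ bΓ , bΔ) =
    replace-antecedent [] [ A ] (bΣ , bΓ , b ∷ bΔ) (m+0<1+m (size A))
  premise-descends (□Tn {A = A}) (bΣ , b ∷ bΓ , bΔ) =
    replace-antecedent [ A ] [] (b ∷ bΣ , <⇒≤ b ∷ bΓ , bΔ) (m+0<1+m (size A))
  premise-descends (□Kn {S = S} _ _ _) (bΣ , _ , s≤s b ∷ _) =
    shallower ([] , All.map ≤-pred (map⁻ (++⁻ʳ S bΣ)) , b ∷ [])

  data Ranked : ℕ × ℕ → TSeq n → Set where
    ranked : ∀ {d s} {boxed : All (Boxed n) (Σs s)} → DepthBounded d s → Ranked (d , weight s) (s , boxed)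

  ≈ₛ-sym : ∀ {s t} → _≈ₛ_ n s t → _≈ₛ_ n t s
  ≈ₛ-sym (Σ↭ , Γ↭ , Δ↭) = ↭-sym Σ↭ , ↭-sym Γ↭ , ↭-sym Δ↭

  step-descends : ∀ {ρ S S′} → Ranked ρ S → Step n S S′ → ∃ λ ρ′ → ρ′ <ₗₑₓ ρ × Ranked ρ′ S′
  step-descends {d , _} {s , _} {s′ , _} (ranked bs) (_ , _ , premise , s≈C , s′≈P)
    with descends⇒<ₗₑₓ (premise-descends premise (DepthBounded-resp-≈ₛ s≈C bs))
  ... | d′ , P<C , bP = (d′ , weight s′) , ρ′<ρ , ranked (DepthBounded-resp-≈ₛ (≈ₛ-sym s′≈P) bP)
    where
    ρ′<ρ : (d′ , weight s′) <ₗₑₓ (d , weight s)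
    ρ′<ρ = subst₂ (λ u v → (d′ , u) <ₗₑₓ (d , v))
                  (sym (weight-resp-≈ₛ s′≈P)) (sym (weight-resp-≈ₛ s≈C)) P<C

proposition4p6 : (n : ℕ) → ¬ (Σ (ℕ → TSeq n) (λ S → (k : ℕ) → Step n (S k) (S (suc k))))
proposition4p6 n (S , chain) =
  wellFounded⇒no-ranked-chain Ranked step-descends (×-wellFounded <-wellFounded <-wellFounded) S
    (ranked (DepthBounded-maxDepth (proj₁ (S 0)))) chain
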